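{- If $H$ is a uniform central graph and $P=\langle CP(H)\rangle$, then $r(P)>1$.
   Context: All graphs are finite and simple. Eccentricity $e(v)=\max_u d(u,v)$; radius $r$ = minimum eccentricity. For a graph $H$: the center $Z(H)$ is the set of vertices of minimum eccentricity; $EC(v)=\{x: d(v,x)=e(v)\}$; the centered periphery is $CP(H)=\bigcup_{z\in Z(H)} EC(z)$; $\langle S\rangle$ is the induced subgraph on $S$. $H$ is a uniform central graph if $EC(c)$ is the same for all $c\in Z(H)$. -}

module Defs where

open import Data.Nat using (ℕ; zero; suc; _⊔_; _⊓_; _≤_; _<_)
open import Data.Fin using (Fin; _≟_)
open import Data.Bool using (Bool; true; false; _∧_; _∨_; if_then_else_)
open import Data.List using (List; foldr; map; allFin)
open import Data.Bool.ListAction using (any)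
open import Data.Product using (Σ; ∃; _×_; _,_)
open import Relation.Binary.PropositionalEquality using (_≡_)
open import Relation.Nullary using (does)
open import Function.Bundles using (_⇔_)
open import Function.Definitions using (Injective)

record Graph (n : ℕ) : Set where
  field
    adj    : Fin n → Fin n → Bool
    sym    : ∀ u v → adj u v ≡ adj v u
    irrefl : ∀ v → adj v v ≡ false
open Graph public

module _ {n : ℕ} (G : Graph n) where

  reach : ℕ → Fin n → Fin n → Bool
  reach zero    u v = does (u ≟ v)
  reach (suc k) u v = reach k u v ∨ any (λ w → reach k u w ∧ adj G w v) (allFin n)

  Connected : Set
  Connected = ∀ u v → ∃ λ k → reach k u v ≡ true

search : (ℕ → Bool) → ℕ → ℕ → ℕ
search p zero    k = k
search p (suc f) k = if p k then k else search p f (suc k)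

module _ {n : ℕ} (G : Graph n) where

  -- Shortest paths in an n-vertex graph have length ≤ n-1, so this is the
  -- usual distance when v is reachable from u; if v is unreachable the
  -- value is n, which plays the role of ∞ (it exceeds every finite distance).
  dist : Fin n → Fin n → ℕ
  dist u v = search (λ k → reach G k u v) n 0

  ecc : Fin n → ℕ
  ecc v = foldr _⊔_ 0 (map (dist v) (allFin n))

  -- radius r = minimum eccentricity (initial value n is ≥ every ecc,
  -- so it does not affect the minimum for n ≥ 1)
  radius : ℕ
  radius = foldr _⊓_ n (map ecc (allFin n))

  InCenter : Fin n → Set
  InCenter z = ecc z ≡ radius

  InEC : Fin n → Fin n → Set
  InEC v x = dist v x ≡ ecc v

  InCP : Fin n → Set
  InCP x = ∃ λ z → InCenter z × InEC z x

  UniformCentral : Set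
  UniformCentral = ∀ c c′ → InCenter c → InCenter c′ → ∀ x → InEC c x ⇔ InEC c′ x

-- P (on Fin m) is (a copy of) the induced subgraph ⟨S⟩ of H (on Fin n):
-- ι is an injective vertex map onto S, and adjacency in P is exactly
-- adjacency in H between the images.
record IsInducedOn {m n : ℕ} (P : Graph m) (H : Graph n) (S : Fin n → Set) : Set where
  field
    ι        : Fin m → Fin n
    ι-inj    : Injective _≡_ _≡_ ι
    ι-onto   : ∀ x → S x ⇔ (∃ λ i → ι i ≡ x)
    ι-adj    : ∀ i j → adj P i j ≡ adj H (ι i) (ι j)

-- Let z be central with r = e(z) > 0, and let x ∈ EC(z). If x were within
-- distance 1 of every vertex of EC(z), the neighbour w of z on a shortest
-- z–x path would be central too: a vertex u with d(z,u) < r is within r of w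
-- through z, and a vertex of EC(z) is within (r − 1) + 1 of w through x.
-- Uniformity then forces d(w,x) = e(w) = r, whereas d(w,x) ≤ r − 1. So every
-- vertex of CP(H) has a vertex of CP(H) at distance at least 2; these pairs are
-- non-adjacent in ⟨CP(H)⟩, so every eccentricity there is at least 2.

module Submission where

open import Defs hiding (sym)
open import Data.Nat using (ℕ; zero; suc; pred; >-nonZero; _+_; _⊔_; _⊓_; _≤_; _<_; z≤n; s≤s; _≤′_; ≤′-refl; ≤′-step)
open import Data.Nat.Properties
open import Data.Fin using (Fin; zero; punchIn; fromℕ<) renaming (_≟_ to _≟ᶠ_)
open import Data.Fin.Properties using (punchInᵢ≢i; any?; toℕ<n)
open import Data.Fin.Subset using (Subset; _⊂_; ⁅_⁆; ∣_∣) renaming (_∈_ to _∈ᵇ_)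
open import Data.Fin.Subset.Properties using (p⊂q⇒∣p∣<∣q∣; p⊆q⇒∣p∣≤∣q∣; ∣p∣≤n; ∣⁅x⁆∣≡1; x∈⁅y⁆⇒x≡y)
open import Data.Vec using (tabulate)
open import Data.Vec.Properties using (lookup∘tabulate; lookup⇒[]=; []=⇒lookup)
open import Data.Bool using (Bool; true; false; T)
open import Data.Bool.Properties using (T-≡; T-∨; T-∧)
open import Data.Empty using (⊥-elim)
open import Data.List using (foldr; map; allFin)
open import Data.List.Properties using (foldr-preservesᵇ; foldr-preservesᵒ)
open import Data.List.Membership.Propositional using (_∈_; lose)
open import Data.List.Membership.Propositional.Properties using (∈-allFin; ∈-map⁺; ∈-map⁻; foldr-selective)
open import Data.List.Relation.Unary.All using (All)
import Data.List.Relation.Unary.All.Properties as All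
open import Data.List.Relation.Unary.Any as Any using (satisfied)
open import Data.List.Relation.Unary.Any.Properties using (any⁺; any⁻)
open import Data.Product using (∃; _×_; _,_; proj₁; proj₂)
open import Data.Sum using (_⊎_; inj₁; inj₂; [_,_])
open import Function using (_∘_)
open import Function.Bundles using (_⇔_; mk⇔; Equivalence)
open import Relation.Nullary using (¬_; contradiction; yes; no)
open import Relation.Nullary.Decidable using (Dec; map′; _×-dec_; T?; dec-true)
open import Relation.Binary.PropositionalEquality using (_≡_; _≢_; refl; sym; trans; subst)

module _ {n : ℕ} (f : Fin n → ℕ) where

  maxOver : ℕ
  maxOver = foldr _⊔_ 0 (map f (allFin n))

  minOver : ℕ → ℕ
  minOver c = foldr _⊓_ c (map f (allFin n))

  private
    all-map : ∀ {P : ℕ → Set} → (∀ x → P (f x)) → All P (map f (allFin n))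
    all-map Pf = All.map⁺ (All.tabulate⁺ Pf)

    selected : ∀ {y} → y ∈ map f (allFin n) → ∃ λ x → f x ≡ y
    selected y∈ with ∈-map⁻ f y∈
    ... | x , _ , y≡fx = x , sym y≡fx

  ≤-maxOver : ∀ x → f x ≤ maxOver
  ≤-maxOver x = foldr-preservesᵒ {P = f x ≤_} {f = _⊔_}
    (λ a b → [ m≤n⇒m≤n⊔o b , m≤n⇒m≤o⊔n a ]) 0 _
    (inj₂ (Any.map (λ { refl → ≤-refl }) (∈-map⁺ f (∈-allFin x))))

  maxOver-≤ : ∀ {c} → (∀ x → f x ≤ c) → maxOver ≤ c
  maxOver-≤ {c} f≤c = foldr-preservesᵇ {P = _≤ c} ⊔-lub z≤n (all-map f≤c)

  maxOver-attained : Fin n → ∃ λ x → f x ≡ maxOver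
  maxOver-attained x₀ with foldr-selective ⊔-sel 0 (map f (allFin n))
  ... | inj₁ max≡0 = x₀ , trans (n≤0⇒n≡0 (subst (f x₀ ≤_) max≡0 (≤-maxOver x₀))) (sym max≡0)
  ... | inj₂ max∈ = selected max∈

  minOver-≤ : ∀ c x → minOver c ≤ f x
  minOver-≤ c x = foldr-preservesᵒ {P = _≤ f x} {f = _⊓_}
    (λ a b → [ m≤n⇒m⊓o≤n b , m≤n⇒o⊓m≤n a ]) c _
    (inj₂ (Any.map (λ { refl → ≤-refl }) (∈-map⁺ f (∈-allFin x))))

  ≤-minOver : ∀ {c k} → k ≤ c → (∀ x → k ≤ f x) → k ≤ minOver c
  ≤-minOver {k = k} k≤c k≤f = foldr-preservesᵇ {P = k ≤_} ⊓-glb k≤c (all-map k≤f)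

  minOver-attained : ∀ {c} → (∀ x → f x ≤ c) → Fin n → ∃ λ x → f x ≡ minOver c
  minOver-attained {c} f≤c x₀ with foldr-selective ⊓-sel c (map f (allFin n))
  ... | inj₁ min≡c = x₀ , ≤-antisym (subst (f x₀ ≤_) (sym min≡c) (f≤c x₀)) (minOver-≤ c x₀)
  ... | inj₂ min∈ = selected min∈

module _ (p : ℕ → Bool) where

  search-≤-bound : ∀ f s → search p f s ≤ s + f
  search-≤-bound zero    s = m≤m+n s 0
  search-≤-bound (suc f) s with p s
  ... | true  = m≤m+n s (suc f)
  ... | false = subst (search p f (suc s) ≤_) (sym (+-suc s f)) (search-≤-bound f (suc s))

  search-≤ : ∀ f s {j} → s ≤ j → T (p j) → search p f s ≤ j
  search-≤ zero    s s≤j _ = s≤j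
  search-≤ (suc f) s s≤j pj with p s in ps | m≤n⇒m<n∨m≡n s≤j
  ... | true  | _        = s≤j
  ... | false | inj₁ s<j = search-≤ f (suc s) s<j pj
  ... | false | inj₂ refl = contradiction (subst T ps pj) λ ()

  search-hit : ∀ f s → search p f s < s + f → T (p (search p f s))
  search-hit zero    s s<s+0 = contradiction (subst (s <_) (+-identityʳ s) s<s+0) (n≮n s)
  search-hit (suc f) s lt with p s in ps
  ... | true  = subst T (sym ps) _
  ... | false = search-hit f (suc s) (subst (search p f (suc s) <_) (+-suc s f) lt)

other-vertex : ∀ {n} → 1 < n → (z : Fin n) → ∃ λ y → y ≢ z
other-vertex {suc zero}    (s≤s ()) _
other-vertex {suc (suc _)} _        z = punchIn z zero , punchInᵢ≢i z zero

distinct-vertices : ∀ {n} {u v : Fin n} → u ≢ v → 1 < n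
distinct-vertices {suc zero}    {zero} {zero} u≢v = contradiction refl u≢v
distinct-vertices {suc (suc _)} _ = s≤s (s≤s z≤n)

module _ {n : ℕ} (G : Graph n) where

  -- A wrapper around T (reach G k u v): unlike the Boolean, which computes for
  -- numeral k, the record type lets Agda infer k, u and v.
  record Reach (k : ℕ) (u v : Fin n) : Set where
    constructor reached
    field holds : T (reach G k u v)
  open Reach public

  reach? : ∀ k u v → Dec (Reach k u v)
  reach? k u v = map′ reached holds (T? (reach G k u v))

  reach-zero⇔ : ∀ {u v} → Reach 0 u v ⇔ u ≡ v
  reach-zero⇔ = mk⇔ to from
    where
    to : ∀ {u v} → Reach 0 u v → u ≡ v
    to {u} {v} (reached r) with u ≟ᶠ v
    ... | yes u≡v = u≡v
    ... | no  _   = ⊥-elim r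
    from : ∀ {u v} → u ≡ v → Reach 0 u v
    from {u} refl = reached (Equivalence.from T-≡ (dec-true (u ≟ᶠ u) refl))

  reach-suc-mono : ∀ {k u v} → Reach k u v → Reach (suc k) u v
  reach-suc-mono (reached r) = reached (Equivalence.from T-∨ (inj₁ r))

  reach-step : ∀ {k u w v} → Reach k u w → T (adj G w v) → Reach (suc k) u v
  reach-step {w = w} (reached r) a = reached
    (Equivalence.from T-∨ (inj₂ (any⁺ _ (lose (∈-allFin w) (Equivalence.from T-∧ (r , a))))))

  reach-suc⁻ : ∀ {k u v} → Reach (suc k) u v →
               Reach k u v ⊎ ∃ λ w → Reach k u w × T (adj G w v)
  reach-suc⁻ (reached r) with Equivalence.to T-∨ r
  ... | inj₁ r′ = inj₁ (reached r′)
  ... | inj₂ r′ with satisfied (any⁻ _ (allFin n) r′)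
  ...   | w , rw with Equivalence.to T-∧ rw
  ...     | r″ , ad = inj₂ (w , reached r″ , ad)

  reach-mono : ∀ {j k u v} → j ≤ k → Reach j u v → Reach k u v
  reach-mono j≤k = go (≤⇒≤′ j≤k)
    where
    go : ∀ {j k u v} → j ≤′ k → Reach j u v → Reach k u v
    go ≤′-refl        r = r
    go (≤′-step j≤′k) r = reach-suc-mono (go j≤′k r)

  reach-refl : ∀ {k u} → Reach k u u
  reach-refl = reach-mono z≤n (Equivalence.from reach-zero⇔ refl)

  reach-+⁺ : ∀ {a b u w v} → Reach a u w → Reach b w v → Reach (a + b) u v
  reach-+⁺ {a} {zero} ra rb with Equivalence.to reach-zero⇔ rb
  ... | refl rewrite +-identityʳ a = ra
  reach-+⁺ {a} {suc b} ra rb rewrite +-suc a b with reach-suc⁻ rb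
  ... | inj₁ rb′            = reach-suc-mono (reach-+⁺ ra rb′)
  ... | inj₂ (_ , rb′ , ad) = reach-step (reach-+⁺ ra rb′) ad

  reach-+⁻ : ∀ {a b u v} → Reach (a + b) u v → ∃ λ w → Reach a u w × Reach b w v
  reach-+⁻ {a} {zero} {v = v} r rewrite +-identityʳ a = v , r , reach-refl
  reach-+⁻ {a} {suc b} r rewrite +-suc a b with reach-suc⁻ r
  ... | inj₁ r′ with reach-+⁻ {a} {b} r′
  ...   | w , ra , rb = w , ra , reach-suc-mono rb
  reach-+⁻ {a} {suc b} r | inj₂ (_ , r′ , ad) with reach-+⁻ {a} {b} r′
  ...   | w , ra , rb = w , ra , reach-step rb ad

  reach-one⇔ : ∀ {u v} → Reach 1 u v ⇔ (u ≡ v ⊎ T (adj G u v))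
  reach-one⇔ = mk⇔ to from
    where
    to : ∀ {u v} → Reach 1 u v → u ≡ v ⊎ T (adj G u v)
    to r with reach-suc⁻ r
    ... | inj₁ r₀            = inj₁ (Equivalence.to reach-zero⇔ r₀)
    ... | inj₂ (_ , r₀ , ad) with Equivalence.to reach-zero⇔ r₀
    ...   | refl = inj₂ ad
    from : ∀ {u v} → u ≡ v ⊎ T (adj G u v) → Reach 1 u v
    from (inj₁ refl) = reach-refl
    from (inj₂ ad)   = reach-step reach-refl ad

  reach-one-sym : ∀ {u v} → Reach 1 u v → Reach 1 v u
  reach-one-sym {u} {v} r with Equivalence.to reach-one⇔ r
  ... | inj₁ refl = reach-refl
  ... | inj₂ ad   = Equivalence.from reach-one⇔ (inj₂ (subst T (Graph.sym G u v) ad))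

  ball : ℕ → Fin n → Subset n
  ball k u = tabulate (reach G k u)

  ∈-ball⁺ : ∀ {k u v} → Reach k u v → v ∈ᵇ ball k u
  ∈-ball⁺ {k} {u} {v} (reached r) =
    lookup⇒[]= v _ (trans (lookup∘tabulate (reach G k u) v) (Equivalence.to T-≡ r))

  ∈-ball⁻ : ∀ {k u v} → v ∈ᵇ ball k u → Reach k u v
  ∈-ball⁻ {k} {u} {v} v∈ =
    reached (Equivalence.from T-≡ (trans (sym (lookup∘tabulate (reach G k u) v)) ([]=⇒lookup v∈)))

  ball-⊂ : ∀ {k u v} → ¬ Reach k u v → Reach (suc k) u v → ball k u ⊂ ball (suc k) u
  ball-⊂ {k} {u} {v} ¬r r =
    (λ x∈ → ∈-ball⁺ (reach-suc-mono (∈-ball⁻ {k} {u} x∈))) , v , ∈-ball⁺ r , ¬r ∘ ∈-ball⁻ {k} {u}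

  ∣ball∣<∣ball-suc∣ : ∀ {k u v} → ¬ Reach k u v → Reach (suc k) u v →
                      ∣ ball k u ∣ < ∣ ball (suc k) u ∣
  ∣ball∣<∣ball-suc∣ {k} {u} ¬r r = p⊂q⇒∣p∣<∣q∣ {p = ball k u} {q = ball (suc k) u} (ball-⊂ ¬r r)

  ball-grows : ∀ {k u v} → ¬ Reach k u v → Reach (suc k) u v → suc k < ∣ ball (suc k) u ∣
  ball-grows {zero} {u} ¬r r = ≤-<-trans one≤ (∣ball∣<∣ball-suc∣ ¬r r)
    where
    one≤ : 1 ≤ ∣ ball 0 u ∣
    one≤ = subst (_≤ ∣ ball 0 u ∣) (∣⁅x⁆∣≡1 u) (p⊆q⇒∣p∣≤∣q∣ {p = ⁅ u ⁆} {q = ball 0 u}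
             (∈-ball⁺ ∘ Equivalence.from reach-zero⇔ ∘ sym ∘ x∈⁅y⁆⇒x≡y u))
  ball-grows {suc k} {u} ¬r r with reach-suc⁻ r
  ... | inj₁ r′ = contradiction r′ ¬r
  ... | inj₂ (y , ry , ad) with reach? k u y
  ...   | yes ry′ = contradiction (reach-step ry′ ad) ¬r
  ...   | no ¬ry′ = ≤-<-trans (ball-grows ¬ry′ ry) (∣ball∣<∣ball-suc∣ ¬r r)

  reach-within : ∀ {k u v} → Reach k u v → ∃ λ j → j < n × Reach j u v
  reach-within {zero} {u} r = 0 , ≤-<-trans z≤n (toℕ<n u) , r
  reach-within {suc k} {u} {v} r with reach? k u v
  ... | yes r′ = reach-within r′
  ... | no ¬r′ = suc k , <-≤-trans (ball-grows ¬r′ r) (∣p∣≤n (ball (suc k) u)) , r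

  dist-≤ : ∀ {k u v} → Reach k u v → dist G u v ≤ k
  dist-≤ (reached r) = search-≤ _ n 0 z≤n r

  dist≤n : ∀ u v → dist G u v ≤ n
  dist≤n u v = search-≤-bound _ n 0

  reach-dist : ∀ {u v} → dist G u v < n → Reach (dist G u v) u v
  reach-dist d<n = reached (search-hit _ n 0 d<n)

  reach-of-dist-≤ : ∀ {j u v} → dist G u v ≤ j → j < n → Reach j u v
  reach-of-dist-≤ d≤j j<n = reach-mono d≤j (reach-dist (≤-<-trans d≤j j<n))

  dist-pos : ∀ {u v} → u ≢ v → 0 < dist G u v
  dist-pos {u} u≢v = ≰⇒> λ d≤0 →
    u≢v (Equivalence.to reach-zero⇔ (reach-of-dist-≤ d≤0 (≤-<-trans z≤n (toℕ<n u))))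

  one<dist : ∀ {u v} → 1 < n → ¬ Reach 1 u v → 1 < dist G u v
  one<dist 1<n ¬r = ≰⇒> λ d≤1 → ¬r (reach-of-dist-≤ d≤1 1<n)

  dist≤ecc : ∀ v u → dist G v u ≤ ecc G v
  dist≤ecc v = ≤-maxOver (dist G v)

  ecc-≤ : ∀ {v c} → (∀ u → dist G v u ≤ c) → ecc G v ≤ c
  ecc-≤ {v} = maxOver-≤ (dist G v)

  radius≤ecc : ∀ v → radius G ≤ ecc G v
  radius≤ecc = minOver-≤ (ecc G) n

  ecc-pos : 1 < n → ∀ z → 0 < ecc G z
  ecc-pos 1<n z with other-vertex 1<n z
  ... | y , y≢z = <-≤-trans (dist-pos (y≢z ∘ sym)) (dist≤ecc z y)

  centered-periphery-nonempty : Fin n → ∃ (InCP G)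
  centered-periphery-nonempty v₀ with minOver-attained (ecc G) (λ v → ecc-≤ (dist≤n v)) v₀
  ... | z , z-central with maxOver-attained (dist G z) z
  ...   | x , x-eccentric = x , z , z-central , x-eccentric

  1<radius : Fin n → (∀ u → ∃ λ v → ¬ Reach 1 u v) → 1 < radius G
  1<radius u₀ far =
    ≤-minOver (ecc G) 1<n λ u → <-≤-trans (one<dist 1<n (proj₂ (far u))) (dist≤ecc u _)
    where
    1<n : 1 < n
    1<n = distinct-vertices (λ u₀≡v → proj₂ (far u₀) (Equivalence.from reach-one⇔ (inj₁ u₀≡v)))

module _ {n : ℕ} {G : Graph n} (connected : Connected G) where

  dist-< : ∀ u v → dist G u v < n
  dist-< u v with connected u v
  ... | k , r with reach-within G (reached {k = k} (Equivalence.from T-≡ r))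
  ...   | j , j<n , r′ = ≤-<-trans (dist-≤ G r′) j<n

  reach-dist-connected : ∀ u v → Reach G (dist G u v) u v
  reach-dist-connected u v = reach-dist G (dist-< u v)

  dist-triangle : ∀ u v w → dist G u w ≤ dist G u v + dist G v w
  dist-triangle u v w = dist-≤ G (reach-+⁺ G (reach-dist-connected u v) (reach-dist-connected v w))

  eccentric-neighbour-central : ∀ {z x} → InCenter G z → 0 < ecc G z → InEC G z x →
                                (∀ y → InEC G z y → dist G x y ≤ 1) →
                                ∃ λ w → InCenter G w × dist G w x < ecc G z
  eccentric-neighbour-central {z} {x} z-central 0<ecc x-ecc x-near =
    w , w-central , subst (dist G w x <_) (sym ecc≡) (s≤s (dist-≤ G w⟶x))
    where
    k : ℕ
    k = pred (ecc G z)
    ecc≡ : ecc G z ≡ suc k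
    ecc≡ = sym (suc-pred (ecc G z) ⦃ >-nonZero 0<ecc ⦄)
    z⟶x : Reach G (1 + k) z x
    z⟶x = subst (λ j → Reach G j z x) (trans x-ecc ecc≡) (reach-dist-connected z x)
    first-step : ∃ λ w → Reach G 1 z w × Reach G k w x
    first-step = reach-+⁻ G {a = 1} z⟶x
    w : Fin n
    w = proj₁ first-step
    w⟶z : Reach G 1 w z
    w⟶z = reach-one-sym G (proj₁ (proj₂ first-step))
    w⟶x : Reach G k w x
    w⟶x = proj₂ (proj₂ first-step)
    w-close : ∀ u → dist G w u ≤ suc k
    w-close u with m≤n⇒m<n∨m≡n (subst (dist G z u ≤_) ecc≡ (dist≤ecc G z u))
    ... | inj₁ (s≤s zu≤k) = begin
      dist G w u              ≤⟨ dist-triangle w z u ⟩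
      dist G w z + dist G z u ≤⟨ +-mono-≤ (dist-≤ G w⟶z) zu≤k ⟩
      suc k                   ∎
      where open ≤-Reasoning
    ... | inj₂ zu≡ = begin
      dist G w u              ≤⟨ dist-triangle w x u ⟩
      dist G w x + dist G x u ≤⟨ +-mono-≤ (dist-≤ G w⟶x) (x-near u (trans zu≡ (sym ecc≡))) ⟩
      k + 1                   ≡⟨ +-comm k 1 ⟩
      suc k                   ∎
      where open ≤-Reasoning
    w-central : InCenter G w
    w-central = ≤-antisym (≤-trans (ecc-≤ G w-close) (≤-reflexive (trans (sym ecc≡) z-central)))
                          (radius≤ecc G w)

  eccentric-not-dominating : ∀ {z x} → 1 < n → UniformCentral G → InCenter G z → InEC G z x →
                             ¬ (∀ y → InEC G z y → dist G x y ≤ 1)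
  eccentric-not-dominating {z} {x} 1<n uniform z-central x-ecc x-near
    with eccentric-neighbour-central z-central (ecc-pos G 1<n z) x-ecc x-near
  ... | w , w-central , wx< = <-irrefl wx≡ wx<
    where
    wx≡ : dist G w x ≡ ecc G z
    wx≡ = trans (Equivalence.to (uniform z w z-central w-central x) x-ecc)
                (trans w-central (sym z-central))

  centered-periphery-far : 1 < n → UniformCentral G → ∀ {x} → InCP G x →
                           ∃ λ y → InCP G y × 1 < dist G x y
  centered-periphery-far 1<n uniform {x} (z , z-central , x-ecc)
    with any? (λ y → (dist G z y ≟ ecc G z) ×-dec (1 <? dist G x y))
  ... | yes (y , y-ecc , far) = y , (z , z-central , y-ecc) , far
  ... | no ∄far = contradiction (λ y y-ecc → ≮⇒≥ (λ far → ∄far (y , y-ecc , far)))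
                                (eccentric-not-dominating 1<n uniform z-central x-ecc)

induced-reach-one : ∀ {m n} {P : Graph m} {H : Graph n} {S : Fin n → Set}
                    (ind : IsInducedOn P H S) →
                    ∀ {i j} → Reach P 1 i j → Reach H 1 (IsInducedOn.ι ind i) (IsInducedOn.ι ind j)
induced-reach-one {P = P} {H} ind {i} {j} r with Equivalence.to (reach-one⇔ P) r
... | inj₁ refl = reach-refl H
... | inj₂ ad   = Equivalence.from (reach-one⇔ H) (inj₂ (subst T (IsInducedOn.ι-adj ind i j) ad))

corollary2p3 : ∀ (n : ℕ) (H : Graph n) → 2 ≤ n → Connected H → UniformCentral H
               → ∀ (m : ℕ) (P : Graph m) → IsInducedOn P H (InCP H)
               → 1 < radius P
corollary2p3 n H 1<n connected uniform m P induced = 1<radius P i₀ far-in-P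
  where
  open IsInducedOn induced
  i₀ : Fin m
  i₀ = proj₁ (Equivalence.to (ι-onto _) (proj₂ (centered-periphery-nonempty H (fromℕ< (<⇒≤ 1<n)))))
  far-in-P : ∀ i → ∃ λ j → ¬ Reach P 1 i j
  far-in-P i with centered-periphery-far connected 1<n uniform
                    (Equivalence.from (ι-onto (ι i)) (i , refl))
  ... | y , y∈ , far with Equivalence.to (ι-onto y) y∈
  ...   | j , refl = j , λ r → <⇒≱ far (dist-≤ H (induced-reach-one induced r))
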